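{- Let $n\ge 5$ and let $P_n$ be the path on $n$ vertices. Define polynomials $\Lambda_k=\Lambda_k(\lambda)$ by $\Lambda_1=\lambda$, $\Lambda_2=\lambda^2-8$, and $\Lambda_k=\lambda\Lambda_{k-1}-8\Lambda_{k-2}$ for every $k\ge 3$. Then the Sombor characteristic polynomial of $P_n$ satisfies $$\phi_{SO}(P_n,\lambda)=\lambda^2\Lambda_{n-2}-10\lambda\Lambda_{n-3}+25\Lambda_{n-4}.$$ Moreover, the Sombor characteristic polynomials of $P_2$, $P_3$ and $P_4$ are $\lambda^2-2$, $\lambda^3-10\lambda$ and $\lambda^4-18\lambda^2+25$, respectively.
   Context: All graphs are simple and finite. For a graph $G$ with vertex set $\{v_1,\dots,v_n\}$, let $d_i$ denote the degree of $v_i$. The Sombor matrix $A_{SO}(G)$ is the $n\times n$ matrix whose $(i,j)$-entry is $\sqrt{d_i^2+d_j^2}$ if $v_i$ and $v_j$ are adjacent and $0$ otherwise. The Sombor characteristic polynomial is $\phi_{SO}(G,\lambda)=\det(\lambda I-A_{SO}(G))$. -}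

module Defs where

open import Data.Nat as ℕ using (ℕ; zero; suc)
open import Data.Fin using (Fin; zero; suc; toℕ; punchIn)
open import Data.Bool using (Bool; true; false; if_then_else_)
open import Data.Nat using (_≡ᵇ_)
open import Relation.Binary.PropositionalEquality using (_≡_)
open import Algebra.Bundles using (CommutativeRing)
open import Level using (Level)

record SimpleGraph (n : ℕ) : Set where
  field
    adj     : Fin n → Fin n → Bool
    symm    : ∀ i j → adj i j ≡ adj j i
    irrefl  : ∀ i → adj i i ≡ false

open SimpleGraph public

sumFinℕ : ∀ {n} → (Fin n → ℕ) → ℕ
sumFinℕ {zero}  f = 0
sumFinℕ {suc n} f = f zero ℕ.+ sumFinℕ (λ i → f (suc i))

degree : ∀ {n} → SimpleGraph n → Fin n → ℕ
degree G i = sumFinℕ (λ j → if adj G i j then 1 else 0)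

diff1 : ℕ → ℕ → Bool
diff1 a b = (suc a ≡ᵇ b) Data.Bool.∨ (suc b ≡ᵇ a)
  where import Data.Bool


pathGraph : (n : ℕ) → SimpleGraph n
pathGraph n = record { adj = λ i j → diff1 (toℕ i) (toℕ j) ; symm = sym' ; irrefl = irr }
  where
    open import Data.Bool.Properties using (∨-comm)
    open import Relation.Binary.PropositionalEquality using (refl)
    sym' : ∀ (i j : Fin n) → diff1 (toℕ i) (toℕ j) ≡ diff1 (toℕ j) (toℕ i)
    sym' i j = ∨-comm (suc (toℕ i) ≡ᵇ toℕ j) (suc (toℕ j) ≡ᵇ toℕ i)
    irr0 : ∀ a → (suc a ≡ᵇ a) ≡ false
    irr0 zero = refl
    irr0 (suc a) = irr0 a
    irr : ∀ (i : Fin n) → diff1 (toℕ i) (toℕ i) ≡ false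
    irr i rewrite irr0 (toℕ i) = refl

module Over {c ℓ : Level} (R : CommutativeRing c ℓ) where
  open CommutativeRing R public using (Carrier; _≈_; _+_; _*_; -_; _-_; 0#; 1#)

  fromℕ : ℕ → Carrier
  fromℕ zero    = 0#
  fromℕ (suc m) = 1# + fromℕ m

  sumFin : ∀ {n} → (Fin n → Carrier) → Carrier
  sumFin {zero}  f = 0#
  sumFin {suc n} f = f zero + sumFin (λ i → f (suc i))

  sign : ℕ → Carrier
  sign zero    = 1#
  sign (suc k) = - sign k

  det : ∀ n → (Fin n → Fin n → Carrier) → Carrier
  det zero    M = 1#
  det (suc n) M = sumFin (λ j → sign (toℕ j) * (M zero j * det n (λ r s → M (suc r) (punchIn j s))))

  -- Sombor matrix of G, given a choice sq of square roots (sq m * sq m ≈ m)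
  somborMatrix : (ℕ → Carrier) → ∀ {n} → SimpleGraph n → Fin n → Fin n → Carrier
  somborMatrix sq G i j =
    if adj G i j then sq (degree G i ℕ.* degree G i ℕ.+ degree G j ℕ.* degree G j) else 0#

  -- Sombor characteristic polynomial det(λI - A_SO(G)) evaluated at λ = x
  somborCharPoly : (ℕ → Carrier) → ∀ {n} → SimpleGraph n → Carrier → Carrier
  somborCharPoly sq {n} G x =
    det n (λ i j → (if toℕ i ≡ᵇ toℕ j then x else 0#) - somborMatrix sq G i j)

  -- Λ_k(λ): Λ_1 = λ, Λ_2 = λ² - 8, Λ_k = λΛ_{k-1} - 8Λ_{k-2}; Λ_0 := 1 is never used.
  Λ : Carrier → ℕ → Carrier
  Λ x zero                  = 1#
  Λ x (suc zero)            = x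
  Λ x (suc (suc zero))      = x * x - fromℕ 8
  Λ x (suc (suc (suc k)))   = x * Λ x (suc (suc k)) - fromℕ 8 * Λ x (suc k)

{-# OPTIONS --safe #-}
module Submission where

-- The matrix λI − A_SO(P_n) is tridiagonal with constant diagonal λ, and the product of its two
-- entries at (i, i+1) and (i+1, i) is d_i² + d_{i+1}², whatever square roots are chosen. Its
-- determinant is therefore the continuant of the weights 5, 8, …, 8, 5 (just 2 for P_2).
-- Expanding along the last row splits off the final 5 and leaves continuants of 5, 8, 8, …;
-- expanding those along the first row leaves continuants of the constant weight 8, which are
-- exactly the Λ_k.

open import Defs
open import Data.Nat as ℕ using (ℕ; zero; suc; _≤_; _<_; _∸_; _≡ᵇ_; s≤s; z≤n)
open import Data.Product using (_×_; _,_)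
open import Algebra.Bundles using (CommutativeRing)
import Data.Nat.Properties as ℕ
open import Data.Bool using (Bool; true; false; _∨_; if_then_else_)
open import Data.Bool.Properties using (∨-comm)
open import Data.Integer as ℤ using (ℤ; +_; -[1+_])
import Data.Integer.Properties as ℤ
open import Data.Sign as Sign using (Sign)
open import Data.Fin using (Fin; zero; suc; toℕ; punchIn)
open import Data.Maybe using (Maybe; map)
open import Relation.Binary.Consequences using (dec⇒weaklyDec)
open import Function using (_∘_)
open import Relation.Nullary using (contradiction)
open import Relation.Binary.PropositionalEquality as ≡ using (_≡_; _≢_; cong; cong₂)

module ℤ-CoefficientSolver {c ℓ} (R : CommutativeRing c ℓ) where
  open Over R using (fromℕ)
  open CommutativeRing R hiding (zero)
  open import Algebra.Properties.Ring ring using (-0#≈0#; -‿involutive; -1*x≈-x)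
  open import Algebra.Properties.Semiring.Mult semiring using (×-homo-+; ×1-homo-*)
    renaming (_×_ to _×ᴿ_)
  open import Algebra.Properties.AbelianGroup +-abelianGroup using (⁻¹-∙-comm)
  open import Algebra.Properties.CommutativeSemigroup *-commutativeSemigroup using (interchange)
  import Algebra.Solver.Ring.AlmostCommutativeRing as ACR
  open import Relation.Binary.Reasoning.Setoid setoid

  fromℕ≡×1# : ∀ n → fromℕ n ≡ n ×ᴿ 1#
  fromℕ≡×1# zero    = ≡.refl
  fromℕ≡×1# (suc n) = ≡.cong (λ t → 1# + t) (fromℕ≡×1# n)

  fromℕ-+ : ∀ m n → fromℕ (m ℕ.+ n) ≈ fromℕ m + fromℕ n
  fromℕ-+ m n rewrite fromℕ≡×1# m | fromℕ≡×1# n | fromℕ≡×1# (m ℕ.+ n) = ×-homo-+ 1# m n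

  fromℕ-* : ∀ m n → fromℕ (m ℕ.* n) ≈ fromℕ m * fromℕ n
  fromℕ-* m n rewrite fromℕ≡×1# m | fromℕ≡×1# n | fromℕ≡×1# (m ℕ.* n) = ×1-homo-* m n

  fromℤ : ℤ → Carrier
  fromℤ (+ n)    = fromℕ n
  fromℤ -[1+ n ] = - fromℕ (suc n)

  fromℤ-neg : ∀ i → fromℤ (ℤ.- i) ≈ - fromℤ i
  fromℤ-neg (+ zero)  = sym -0#≈0#
  fromℤ-neg (+ suc n) = refl
  fromℤ-neg -[1+ n ]  = sym (-‿involutive _)

  fromℤ-⊖ : ∀ m n → fromℤ (m ℤ.⊖ n) ≈ fromℕ m - fromℕ n
  fromℤ-⊖ m       zero    = sym (trans (+-congˡ -0#≈0#) (+-identityʳ _))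
  fromℤ-⊖ zero    (suc n) = sym (+-identityˡ _)
  fromℤ-⊖ (suc m) (suc n) = begin
    fromℤ (suc m ℤ.⊖ suc n)               ≡⟨ ≡.cong fromℤ (ℤ.[1+m]⊖[1+n]≡m⊖n m n) ⟩
    fromℤ (m ℤ.⊖ n)                        ≈⟨ fromℤ-⊖ m n ⟩
    fromℕ m - fromℕ n                      ≈⟨ +-congˡ (+-identityˡ _) ⟨
    fromℕ m + (0# - fromℕ n)               ≈⟨ +-congˡ (+-congʳ (-‿inverseʳ 1#)) ⟨
    fromℕ m + ((1# - 1#) - fromℕ n)        ≈⟨ +-congˡ (+-assoc _ _ _) ⟩
    fromℕ m + (1# + (- 1# - fromℕ n))      ≈⟨ +-assoc _ _ _ ⟨
    (fromℕ m + 1#) + (- 1# - fromℕ n)      ≈⟨ +-cong (+-comm _ _) (⁻¹-∙-comm _ _) ⟩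
    fromℕ (suc m) - fromℕ (suc n)          ∎

  fromℤ-+ : ∀ i j → fromℤ (i ℤ.+ j) ≈ fromℤ i + fromℤ j
  fromℤ-+ (+ m)    (+ n)    = fromℕ-+ m n
  fromℤ-+ (+ m)    -[1+ n ] = fromℤ-⊖ m (suc n)
  fromℤ-+ -[1+ m ] (+ n)    = trans (fromℤ-⊖ n (suc m)) (+-comm _ _)
  fromℤ-+ -[1+ m ] -[1+ n ] = begin
    - fromℕ (suc (suc (m ℕ.+ n)))          ≡⟨ ≡.cong (λ k → - fromℕ (suc k)) (ℕ.+-suc m n) ⟨
    - fromℕ (suc m ℕ.+ suc n)              ≈⟨ -‿cong (fromℕ-+ (suc m) (suc n)) ⟩
    - (fromℕ (suc m) + fromℕ (suc n))      ≈⟨ ⁻¹-∙-comm _ _ ⟨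
    - fromℕ (suc m) + - fromℕ (suc n)      ∎

  fromSign : Sign → Carrier
  fromSign Sign.+ = 1#
  fromSign Sign.- = - 1#

  fromSign-* : ∀ s t → fromSign (s Sign.* t) ≈ fromSign s * fromSign t
  fromSign-* Sign.+ t      = sym (*-identityˡ _)
  fromSign-* Sign.- Sign.+ = sym (*-identityʳ _)
  fromSign-* Sign.- Sign.- = sym (trans (-1*x≈-x _) (-‿involutive _))

  fromℤ-◃ : ∀ s n → fromℤ (s ℤ.◃ n) ≈ fromSign s * fromℕ n
  fromℤ-◃ Sign.+ n rewrite ℤ.+◃n≡+n n = sym (*-identityˡ _)
  fromℤ-◃ Sign.- n rewrite ℤ.-◃n≡-n n = trans (fromℤ-neg (+ n)) (sym (-1*x≈-x _))

  fromℤ-signAbs : ∀ i → fromℤ i ≈ fromSign (ℤ.sign i) * fromℕ ℤ.∣ i ∣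
  fromℤ-signAbs (+ n)    = sym (*-identityˡ _)
  fromℤ-signAbs -[1+ n ] = sym (-1*x≈-x _)

  fromℤ-* : ∀ i j → fromℤ (i ℤ.* j) ≈ fromℤ i * fromℤ j
  fromℤ-* i j = begin
    fromℤ (i ℤ.* j)
      ≈⟨ fromℤ-◃ (ℤ.sign i Sign.* ℤ.sign j) (ℤ.∣ i ∣ ℕ.* ℤ.∣ j ∣) ⟩
    fromSign (ℤ.sign i Sign.* ℤ.sign j) * fromℕ (ℤ.∣ i ∣ ℕ.* ℤ.∣ j ∣)
      ≈⟨ *-cong (fromSign-* (ℤ.sign i) (ℤ.sign j)) (fromℕ-* ℤ.∣ i ∣ ℤ.∣ j ∣) ⟩
    (fromSign (ℤ.sign i) * fromSign (ℤ.sign j)) * (fromℕ ℤ.∣ i ∣ * fromℕ ℤ.∣ j ∣)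
      ≈⟨ interchange _ _ _ _ ⟩
    (fromSign (ℤ.sign i) * fromℕ ℤ.∣ i ∣) * (fromSign (ℤ.sign j) * fromℕ ℤ.∣ j ∣)
      ≈⟨ *-cong (fromℤ-signAbs i) (fromℤ-signAbs j) ⟨
    fromℤ i * fromℤ j ∎

  -- Agrees with fromℤ except at 1, where it is 1# itself rather than 1# + 0#, so that
  -- the solver's constant 1 denotes the 1# occurring in goals.
  fromℤ′ : ℤ → Carrier
  fromℤ′ (+ 1) = 1#
  fromℤ′ i     = fromℤ i

  fromℤ′≈fromℤ : ∀ i → fromℤ′ i ≈ fromℤ i
  fromℤ′≈fromℤ (+ zero)        = refl
  fromℤ′≈fromℤ (+ suc zero)    = sym (+-identityʳ 1#)
  fromℤ′≈fromℤ (+ suc (suc n)) = refl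
  fromℤ′≈fromℤ -[1+ n ]        = refl

  fromℤ′-homomorphism : ℤ.+-*-rawRing ACR.-Raw-AlmostCommutative⟶ ACR.fromCommutativeRing R
  fromℤ′-homomorphism = record
    { ⟦_⟧    = fromℤ′
    ; +-homo = λ i j → transport (i ℤ.+ j) (+-cong (fromℤ′≈fromℤ i) (fromℤ′≈fromℤ j)) (fromℤ-+ i j)
    ; *-homo = λ i j → transport (i ℤ.* j) (*-cong (fromℤ′≈fromℤ i) (fromℤ′≈fromℤ j)) (fromℤ-* i j)
    ; -‿homo = λ i → transport (ℤ.- i) (-‿cong (fromℤ′≈fromℤ i)) (fromℤ-neg i)
    ; 0-homo = refl
    ; 1-homo = refl
    }
    where
    transport : ∀ k {a b} → a ≈ b → fromℤ k ≈ b → fromℤ′ k ≈ a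
    transport k a≈b k≈b = trans (fromℤ′≈fromℤ k) (trans k≈b (sym a≈b))

  fromℤ′-≟ : ∀ i j → Maybe (fromℤ′ i ≈ fromℤ′ j)
  fromℤ′-≟ i j = map (λ { ≡.refl → refl }) (dec⇒weaklyDec ℤ._≟_ i j)

  open import Algebra.Solver.Ring ℤ.+-*-rawRing (ACR.fromCommutativeRing R) fromℤ′-homomorphism fromℤ′-≟ public
    using (solve; _:+_; _:-_; _:*_; :-_; con; _:=_)

module Laplace {c ℓ} (R : CommutativeRing c ℓ) where
  open Over R using (sumFin; sign; det)
  open CommutativeRing R hiding (zero)
  open ℤ-CoefficientSolver R
  open import Relation.Binary.Reasoning.Setoid setoid

  Matrix : ℕ → Set c
  Matrix n = Fin n → Fin n → Carrier

  minor : ∀ {n} → Matrix (suc n) → Fin (suc n) → Matrix n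
  minor M j r s = M (suc r) (punchIn j s)

  laplaceTerm : ∀ {n} → Matrix (suc n) → Fin (suc n) → Carrier
  laplaceTerm {n} M j = sign (toℕ j) * (M zero j * det n (minor M j))

  sumFin-zero : ∀ {n} {f : Fin n → Carrier} → (∀ i → f i ≈ 0#) → sumFin f ≈ 0#
  sumFin-zero {zero}  f≈0 = refl
  sumFin-zero {suc n} f≈0 = trans (+-cong (f≈0 zero) (sumFin-zero (λ i → f≈0 (suc i)))) (+-identityʳ 0#)

  laplaceTerm-entry≈0 : ∀ {n} (M : Matrix (suc n)) j → M zero j ≈ 0# → laplaceTerm M j ≈ 0#
  laplaceTerm-entry≈0 M j Mj≈0 = trans (*-congˡ (trans (*-congʳ Mj≈0) (zeroˡ _))) (zeroʳ _)

  laplaceTerm-minor≈0 : ∀ {n} (M : Matrix (suc n)) j → det n (minor M j) ≈ 0# → laplaceTerm M j ≈ 0#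
  laplaceTerm-minor≈0 M j minor≈0 = trans (*-congˡ (trans (*-congˡ minor≈0) (zeroʳ _))) (zeroʳ _)

  det-zeroFirstColumn : ∀ n (M : Matrix (suc n)) → (∀ i → M i zero ≈ 0#) → det (suc n) M ≈ 0#
  det-zeroFirstColumn n M col≈0 = sumFin-zero (term≈0 n M col≈0)
    where
    term≈0 : ∀ n (M : Matrix (suc n)) → (∀ i → M i zero ≈ 0#) → ∀ j → laplaceTerm M j ≈ 0#
    term≈0 n       M col≈0 zero    = laplaceTerm-entry≈0 M zero (col≈0 zero)
    term≈0 (suc n) M col≈0 (suc j) =
      laplaceTerm-minor≈0 M (suc j) (det-zeroFirstColumn n (minor M (suc j)) (λ i → col≈0 (suc i)))

  det-sparseFirstColumn : ∀ n (M : Matrix (suc n)) → (∀ i → M (suc i) zero ≈ 0#) →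
                          det (suc n) M ≈ M zero zero * det n (minor M zero)
  det-sparseFirstColumn n M col≈0 = begin
    det (suc n) M                                   ≈⟨ +-congˡ (tail≈0 n M col≈0) ⟩
    1# * (M zero zero * det n (minor M zero)) + 0#  ≈⟨ solve 1 (λ t → con (+ 1) :* t :+ con (+ 0) := t) refl _ ⟩
    M zero zero * det n (minor M zero)              ∎
    where
    tail≈0 : ∀ n (M : Matrix (suc n)) → (∀ i → M (suc i) zero ≈ 0#) →
             sumFin (λ j → laplaceTerm M (suc j)) ≈ 0#
    tail≈0 zero    M col≈0 = refl
    tail≈0 (suc n) M col≈0 = sumFin-zero λ j →
      laplaceTerm-minor≈0 M (suc j) (det-zeroFirstColumn n (minor M (suc j)) col≈0)

  det-sparseFirstRow : ∀ m (M : Matrix (suc (suc m))) → (∀ j → M zero (suc (suc j)) ≈ 0#) →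
                       det (suc (suc m)) M ≈ M zero zero * det (suc m) (minor M zero)
                                           - M zero (suc zero) * det (suc m) (minor M (suc zero))
  det-sparseFirstRow m M row≈0 = begin
    det (suc (suc m)) M
      ≈⟨ +-congˡ (+-congˡ (sumFin-zero λ j → laplaceTerm-entry≈0 M (suc (suc j)) (row≈0 j))) ⟩
    1# * (a * A) + (- 1# * (b * B) + 0#)
      ≈⟨ solve 4 (λ a A b B → con (+ 1) :* (a :* A) :+ (:- con (+ 1) :* (b :* B) :+ con (+ 0))
                              := a :* A :- b :* B) refl a A b B ⟩
    a * A - b * B ∎
    where
    a = M zero zero
    b = M zero (suc zero)
    A = det (suc m) (minor M zero)
    B = det (suc m) (minor M (suc zero))

module Continuant {c ℓ} (R : CommutativeRing c ℓ) where
  open Over R using (det)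
  open CommutativeRing R hiding (zero)
  open ℤ-CoefficientSolver R
  open Laplace R
  open import Relation.Binary.Reasoning.Setoid setoid

  continuant : Carrier → (ℕ → Carrier) → ℕ → Carrier
  continuant x b zero          = 1#
  continuant x b (suc zero)    = x
  continuant x b (suc (suc m)) =
    x * continuant x (λ i → b (suc i)) (suc m) - b 0 * continuant x (λ i → b (suc (suc i))) m

  continuant-cong : ∀ {x b b′} n → (∀ i → suc i < n → b i ≈ b′ i) →
                    continuant x b n ≈ continuant x b′ n
  continuant-cong zero          b≈b′ = refl
  continuant-cong (suc zero)    b≈b′ = refl
  continuant-cong (suc (suc m)) b≈b′ =
    +-cong (*-congˡ (continuant-cong (suc m) λ i i<m → b≈b′ (suc i) (s≤s i<m)))
           (-‿cong (*-cong (b≈b′ 0 (s≤s (s≤s z≤n)))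
                           (continuant-cong m λ i i<m → b≈b′ (suc (suc i)) (s≤s (s≤s i<m)))))

  continuant-snoc : ∀ x b n →
    continuant x b (suc (suc n)) ≈ x * continuant x b (suc n) - b n * continuant x b n
  continuant-snoc x b zero          = refl
  continuant-snoc x b (suc zero)    =
    solve 3 (λ x b₀ b₁ → x :* (x :* x :- b₁ :* con (+ 1)) :- b₀ :* x
                       := x :* (x :* x :- b₀ :* con (+ 1)) :- b₁ :* x)
      refl x (b 0) (b 1)
  continuant-snoc x b (suc (suc n)) = begin
    x * K₁ (suc (suc (suc n))) - b 0 * K₂ (suc (suc n))
      ≈⟨ +-cong (*-congˡ (continuant-snoc x (λ i → b (suc i)) (suc n)))
                (-‿cong (*-congˡ (continuant-snoc x (λ i → b (suc (suc i))) n))) ⟩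
    x * (x * K₁ (suc (suc n)) - bₙ * K₁ (suc n)) - b 0 * (x * K₂ (suc n) - bₙ * K₂ n)
      ≈⟨ solve 7 (λ x b₀ bₙ p q r s → x :* (x :* p :- bₙ :* q) :- b₀ :* (x :* r :- bₙ :* s)
                                       := x :* (x :* p :- b₀ :* r) :- bₙ :* (x :* q :- b₀ :* s))
           refl x (b 0) bₙ (K₁ (suc (suc n))) (K₁ (suc n)) (K₂ (suc n)) (K₂ n) ⟩
    x * continuant x b (suc (suc (suc n))) - bₙ * continuant x b (suc (suc n)) ∎
    where
    bₙ = b (suc (suc n))
    K₁ = continuant x (λ i → b (suc i))
    K₂ = continuant x (λ i → b (suc (suc i)))

  toMatrix : (ℕ → ℕ → Carrier) → ∀ n → Matrix n
  toMatrix a n i j = a (toℕ i) (toℕ j)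

  shift : (ℕ → ℕ → Carrier) → ℕ → ℕ → Carrier
  shift a i j = a (suc i) (suc j)

  offDiagonalProduct : (ℕ → ℕ → Carrier) → ℕ → Carrier
  offDiagonalProduct a i = a i (suc i) * a (suc i) i

  record Tridiagonal (x : Carrier) (a : ℕ → ℕ → Carrier) : Set ℓ where
    field
      diagonal : ∀ i → a i i ≈ x
      above    : ∀ i j → a i (suc (suc (i ℕ.+ j))) ≈ 0#
      below    : ∀ i j → a (suc (suc (i ℕ.+ j))) i ≈ 0#

  Tridiagonal-shift : ∀ {x a} → Tridiagonal x a → Tridiagonal x (shift a)
  Tridiagonal-shift t = record
    { diagonal = λ i → diagonal (suc i)
    ; above    = λ i → above (suc i)
    ; below    = λ i → below (suc i)
    }
    where open Tridiagonal t

  det-tridiagonal : ∀ {x a} → Tridiagonal x a → ∀ n →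
                    det n (toMatrix a n) ≈ continuant x (offDiagonalProduct a) n
  det-tridiagonal         t zero          = refl
  det-tridiagonal {x} {a} t (suc zero)    = begin
    det 1 (toMatrix a 1) ≈⟨ det-sparseFirstColumn 0 (toMatrix a 1) (λ ()) ⟩
    a 0 0 * 1#           ≈⟨ *-identityʳ _ ⟩
    a 0 0                ≈⟨ Tridiagonal.diagonal t 0 ⟩
    x                    ∎
  det-tridiagonal {x} {a} t (suc (suc m)) = begin
    det (suc (suc m)) (toMatrix a _)
      ≈⟨ det-sparseFirstRow m (toMatrix a _) (λ j → above 0 (toℕ j)) ⟩
    a 0 0 * det (suc m) (toMatrix (shift a) _) - a 0 1 * det (suc m) (minor (toMatrix a _) (suc zero))
      ≈⟨ +-congˡ (-‿cong (*-congˡ (det-sparseFirstColumn m (minor (toMatrix a _) (suc zero))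
                                                         (λ i → below 0 (toℕ i))))) ⟩
    a 0 0 * det (suc m) (toMatrix (shift a) _) - a 0 1 * (a 1 0 * det m (toMatrix (shift (shift a)) m))
      ≈⟨ +-cong (*-cong (diagonal 0) (det-tridiagonal (Tridiagonal-shift t) (suc m)))
                (-‿cong (trans (sym (*-assoc _ _ _))
                               (*-congˡ (det-tridiagonal (Tridiagonal-shift (Tridiagonal-shift t)) m)))) ⟩
    continuant x (offDiagonalProduct a) (suc (suc m)) ∎
    where open Tridiagonal t

  open Over R using (fromℕ; Λ)

  continuant-const8≈Λ : ∀ x m → continuant x (λ _ → fromℕ 8) m ≈ Λ x m
  continuant-const8≈Λ x zero                = refl
  continuant-const8≈Λ x (suc zero)          = refl
  continuant-const8≈Λ x (suc (suc zero))    = +-congˡ (-‿cong (*-identityʳ _))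
  continuant-const8≈Λ x (suc (suc (suc m))) =
    +-cong (*-congˡ (continuant-const8≈Λ x (suc (suc m)))) (-‿cong (*-congˡ (continuant-const8≈Λ x (suc m))))

≡ᵇ-refl : ∀ n → (n ≡ᵇ n) ≡ true
≡ᵇ-refl zero    = ≡.refl
≡ᵇ-refl (suc n) = ≡ᵇ-refl n

≢⇒≡ᵇ≡false : ∀ {m n} → m ≢ n → (m ≡ᵇ n) ≡ false
≢⇒≡ᵇ≡false {zero}  {zero}  m≢n = contradiction ≡.refl m≢n
≢⇒≡ᵇ≡false {zero}  {suc n} _   = ≡.refl
≢⇒≡ᵇ≡false {suc m} {zero}  _   = ≡.refl
≢⇒≡ᵇ≡false {suc m} {suc n} m≢n = ≢⇒≡ᵇ≡false (m≢n ∘ cong suc)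

diff1-sym : ∀ a b → diff1 a b ≡ diff1 b a
diff1-sym a b = ∨-comm (suc a ≡ᵇ b) (suc b ≡ᵇ a)

diff1-irrefl : ∀ a → diff1 a a ≡ false
diff1-irrefl a = cong₂ _∨_ 1+a≢a 1+a≢a
  where 1+a≢a = ≢⇒≡ᵇ≡false (ℕ.1+n≢n {a})

diff1-suc : ∀ a → diff1 a (suc a) ≡ true
diff1-suc a = cong (_∨ (suc (suc a) ≡ᵇ a)) (≡ᵇ-refl a)

diff1-far : ∀ {a b} → suc a < b → diff1 a b ≡ false
diff1-far {a} a+1<b = cong₂ _∨_ (≢⇒≡ᵇ≡false (ℕ.<⇒≢ a+1<b))
                                (≢⇒≡ᵇ≡false (ℕ.>⇒≢ (ℕ.<-trans (ℕ.n<1+n a) (ℕ.m<n⇒m<1+n a+1<b))))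

sumFinℕ-zero : ∀ n → sumFinℕ {n} (λ _ → 0) ≡ 0
sumFinℕ-zero zero    = ≡.refl
sumFinℕ-zero (suc n) = sumFinℕ-zero n

pathDegree : ℕ → ℕ → ℕ
pathDegree n a = sumFinℕ {n} (λ j → if diff1 a (toℕ j) then 1 else 0)

pathDegree-first : ∀ n → pathDegree (suc (suc n)) 0 ≡ 1
pathDegree-first n = cong suc (sumFinℕ-zero n)

pathDegree-last : ∀ n → pathDegree (suc (suc n)) (suc n) ≡ 1
pathDegree-last zero    = ≡.refl
pathDegree-last (suc n) = pathDegree-last n

pathDegree-inner : ∀ {n a} → a < n → pathDegree (suc (suc n)) (suc a) ≡ 2
pathDegree-inner {suc n} {zero}  _           = cong (2 ℕ.+_) (sumFinℕ-zero n)
pathDegree-inner {suc n} {suc a} (s≤s a<n) = pathDegree-inner a<n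

squareSum : ℕ → ℕ → ℕ
squareSum d d′ = d ℕ.* d ℕ.+ d′ ℕ.* d′

squareSum-comm : ∀ d d′ → squareSum d d′ ≡ squareSum d′ d
squareSum-comm d d′ = ℕ.+-comm (d ℕ.* d) (d′ ℕ.* d′)

pathWeight : ℕ → ℕ → ℕ
pathWeight n i = squareSum (pathDegree n i) (pathDegree n (suc i))

rayWeight : ℕ → ℕ
rayWeight zero    = 5
rayWeight (suc i) = 8

pathWeight-ray : ∀ {k i} → i ≤ k → pathWeight (suc (suc (suc k))) i ≡ rayWeight i
pathWeight-ray {k}     {zero}  _ = cong₂ squareSum (pathDegree-first (suc k)) (pathDegree-inner {suc k} (s≤s z≤n))
pathWeight-ray {suc k} {suc i} (s≤s i≤k) =
  cong₂ squareSum (pathDegree-inner {suc (suc k)} (s≤s (ℕ.m≤n⇒m≤1+n i≤k)))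
        (pathDegree-inner {suc (suc k)} (s≤s (s≤s i≤k)))

pathWeight-last : ∀ k → pathWeight (suc (suc (suc k))) (suc k) ≡ 5
pathWeight-last k = cong₂ squareSum (pathDegree-inner {suc k} (ℕ.n<1+n k)) (pathDegree-last (suc k))

module SomborPath {c ℓ} (R : CommutativeRing c ℓ) (sq : ℕ → CommutativeRing.Carrier R)
  (sq-square : ∀ m → CommutativeRing._≈_ R (CommutativeRing._*_ R (sq m) (sq m)) (Over.fromℕ R m)) where
  open Over R using (fromℕ; Λ; somborCharPoly)
  open CommutativeRing R hiding (zero)
  open ℤ-CoefficientSolver R
  open Continuant R
  open import Algebra.Properties.Ring ring using (-0#≈0#)
  open import Relation.Binary.Reasoning.Setoid setoid

  module _ {x s : Carrier} {p q : Bool} where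
    entry-diagonal : p ≡ true → q ≡ false → (if p then x else 0#) - (if q then s else 0#) ≈ x
    entry-diagonal ≡.refl ≡.refl = trans (+-congˡ (-0#≈0#)) (+-identityʳ x)

    entry-zero : p ≡ false → q ≡ false → (if p then x else 0#) - (if q then s else 0#) ≈ 0#
    entry-zero ≡.refl ≡.refl = trans (+-congˡ (-0#≈0#)) (+-identityʳ 0#)

    entry-adjacent : p ≡ false → q ≡ true → (if p then x else 0#) - (if q then s else 0#) ≈ - s
    entry-adjacent ≡.refl ≡.refl = +-identityˡ (- s)

  ray : ℕ → Carrier
  ray = fromℕ ∘ rayWeight

  continuant-ray : ∀ x m → continuant x ray (suc (suc m)) ≈ x * Λ x (suc m) - fromℕ 5 * Λ x m
  continuant-ray x m =
    +-cong (*-congˡ (continuant-const8≈Λ x (suc m))) (-‿cong (*-congˡ (continuant-const8≈Λ x m)))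

  pathCharMatrix : ℕ → Carrier → ℕ → ℕ → Carrier
  pathCharMatrix n x a b =
    (if a ≡ᵇ b then x else 0#)
    - (if diff1 a b then sq (squareSum (pathDegree n a) (pathDegree n b)) else 0#)

  pathCharMatrix-tridiagonal : ∀ n x → Tridiagonal x (pathCharMatrix n x)
  pathCharMatrix-tridiagonal n x = record
    { diagonal = λ i → entry-diagonal (≡ᵇ-refl i) (diff1-irrefl i)
    ; above    = λ i j → entry-zero (≢⇒≡ᵇ≡false (ℕ.<⇒≢ (before i j))) (diff1-far (far i j))
    ; below    = λ i j → entry-zero (≢⇒≡ᵇ≡false (ℕ.>⇒≢ (before i j)))
                                    (≡.trans (diff1-sym _ i) (diff1-far (far i j)))
    }
    where
    far : ∀ i j → suc i < suc (suc (i ℕ.+ j))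
    far i j = s≤s (s≤s (ℕ.m≤m+n i j))
    before : ∀ i j → i < suc (suc (i ℕ.+ j))
    before i j = ℕ.<-trans (ℕ.n<1+n i) (far i j)

  pathCharMatrix-offDiagonalProduct : ∀ n x i →
    offDiagonalProduct (pathCharMatrix n x) i ≈ fromℕ (pathWeight n i)
  pathCharMatrix-offDiagonalProduct n x i = begin
    pathCharMatrix n x i (suc i) * pathCharMatrix n x (suc i) i
      ≈⟨ *-cong (entry-adjacent (≢⇒≡ᵇ≡false (ℕ.<⇒≢ (ℕ.n<1+n i))) (diff1-suc i))
                (entry-adjacent (≢⇒≡ᵇ≡false (ℕ.>⇒≢ (ℕ.n<1+n i))) (≡.trans (diff1-sym (suc i) i) (diff1-suc i))) ⟩
    - sq (pathWeight n i) * - sq (squareSum (pathDegree n (suc i)) (pathDegree n i))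
      ≡⟨ cong (λ w → - sq (pathWeight n i) * - sq w) (squareSum-comm (pathDegree n (suc i)) (pathDegree n i)) ⟩
    - sq (pathWeight n i) * - sq (pathWeight n i)
      ≈⟨ solve 1 (λ t → :- t :* :- t := t :* t) refl (sq (pathWeight n i)) ⟩
    sq (pathWeight n i) * sq (pathWeight n i)
      ≈⟨ sq-square (pathWeight n i) ⟩
    fromℕ (pathWeight n i) ∎

  pathCharPoly≈continuant : ∀ n x →
    somborCharPoly sq (pathGraph n) x ≈ continuant x (fromℕ ∘ pathWeight n) n
  pathCharPoly≈continuant n x =
    trans (det-tridiagonal (pathCharMatrix-tridiagonal n x) n)
          (continuant-cong n (λ i _ → pathCharMatrix-offDiagonalProduct n x i))

  pathCharPoly-ray : ∀ k x → somborCharPoly sq (pathGraph (suc (suc (suc k)))) x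
                           ≈ x * continuant x ray (suc (suc k)) - fromℕ 5 * continuant x ray (suc k)
  pathCharPoly-ray k x = begin
    somborCharPoly sq (pathGraph (suc (suc (suc k)))) x
      ≈⟨ pathCharPoly≈continuant (suc (suc (suc k))) x ⟩
    continuant x w (suc (suc (suc k)))
      ≈⟨ continuant-snoc x w (suc k) ⟩
    x * continuant x w (suc (suc k)) - w (suc k) * continuant x w (suc k)
      ≈⟨ +-cong (*-congˡ (continuant-cong (suc (suc k)) λ { i (s≤s (s≤s i≤k)) → w≈ray i≤k }))
                (-‿cong (*-cong (reflexive (cong fromℕ (pathWeight-last k)))
                                (continuant-cong (suc k) λ { i (s≤s i<k) → w≈ray (ℕ.<⇒≤ i<k) }))) ⟩
    x * continuant x ray (suc (suc k)) - fromℕ 5 * continuant x ray (suc k) ∎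
    where
    w = fromℕ ∘ pathWeight (suc (suc (suc k)))
    w≈ray : ∀ {i} → i ≤ k → w i ≈ ray i
    w≈ray i≤k = reflexive (cong fromℕ (pathWeight-ray i≤k))

  pathCharPoly-≥5 : ∀ n → 5 ≤ n → ∀ x → somborCharPoly sq (pathGraph n) x
    ≈ x * x * Λ x (n ∸ 2) - fromℕ 10 * x * Λ x (n ∸ 3) + fromℕ 25 * Λ x (n ∸ 4)
  pathCharPoly-≥5 .(suc (suc (suc (suc (suc j))))) (s≤s (s≤s (s≤s (s≤s (s≤s {n = j} _))))) x = begin
    somborCharPoly sq (pathGraph (5 ℕ.+ j)) x
      ≈⟨ pathCharPoly-ray (2 ℕ.+ j) x ⟩
    x * continuant x ray (4 ℕ.+ j) - fromℕ 5 * continuant x ray (3 ℕ.+ j)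
      ≈⟨ +-cong (*-congˡ (continuant-ray x (2 ℕ.+ j))) (-‿cong (*-congˡ (continuant-ray x (1 ℕ.+ j)))) ⟩
    x * (x * Λ x (3 ℕ.+ j) - fromℕ 5 * Λ x (2 ℕ.+ j)) - fromℕ 5 * (x * Λ x (2 ℕ.+ j) - fromℕ 5 * Λ x (1 ℕ.+ j))
      ≈⟨ solve 4 (λ x A B C → x :* (x :* A :- con (+ 5) :* B) :- con (+ 5) :* (x :* B :- con (+ 5) :* C)
                              := x :* x :* A :- con (+ 10) :* x :* B :+ con (+ 25) :* C)
           refl x (Λ x (3 ℕ.+ j)) (Λ x (2 ℕ.+ j)) (Λ x (1 ℕ.+ j)) ⟩
    x * x * Λ x (3 ℕ.+ j) - fromℕ 10 * x * Λ x (2 ℕ.+ j) + fromℕ 25 * Λ x (1 ℕ.+ j) ∎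

  pathCharPoly-P₂ : ∀ x → somborCharPoly sq (pathGraph 2) x ≈ x * x - fromℕ 2
  pathCharPoly-P₂ x = trans (pathCharPoly≈continuant 2 x) (+-congˡ (-‿cong (*-identityʳ (fromℕ 2))))

  pathCharPoly-P₃ : ∀ x → somborCharPoly sq (pathGraph 3) x ≈ x * x * x - fromℕ 10 * x
  pathCharPoly-P₃ x = trans (pathCharPoly-ray 0 x)
    (solve 1 (λ x → x :* (x :* x :- con (+ 5) :* con (+ 1)) :- con (+ 5) :* x
                    := x :* x :* x :- con (+ 10) :* x) refl x)

  pathCharPoly-P₄ : ∀ x → somborCharPoly sq (pathGraph 4) x ≈ x * x * x * x - fromℕ 18 * (x * x) + fromℕ 25
  pathCharPoly-P₄ x = trans (pathCharPoly-ray 1 x)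
    (solve 1 (λ x → x :* (x :* (x :* x :- con (+ 8) :* con (+ 1)) :- con (+ 5) :* x)
                      :- con (+ 5) :* (x :* x :- con (+ 5) :* con (+ 1))
                    := x :* x :* x :* x :- con (+ 18) :* (x :* x) :+ con (+ 25)) refl x)

mainTheorem1 : ∀ {c ℓ} (R : CommutativeRing c ℓ) → let open Over R in
    (sq : ℕ → Carrier) → (∀ m → sq m * sq m ≈ fromℕ m) →
    (∀ n → 5 ≤ n → ∀ x →
        somborCharPoly sq (pathGraph n) x
          ≈ x * x * Λ x (n ∸ 2) - fromℕ 10 * x * Λ x (n ∸ 3) + fromℕ 25 * Λ x (n ∸ 4))
    × (∀ x → somborCharPoly sq (pathGraph 2) x ≈ x * x - fromℕ 2)
    × (∀ x → somborCharPoly sq (pathGraph 3) x ≈ x * x * x - fromℕ 10 * x)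
    × (∀ x → somborCharPoly sq (pathGraph 4) x ≈ x * x * x * x - fromℕ 18 * (x * x) + fromℕ 25)
mainTheorem1 R sq sq-square = pathCharPoly-≥5 , pathCharPoly-P₂ , pathCharPoly-P₃ , pathCharPoly-P₄
  where open SomborPath R sq sq-square
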